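{- Let $A$ be an $n\times n\times n$ integer hypermatrix. Then $\Xi(A)$ is a corner-sum hypermatrix of order $n$ if and only if all entries of the partial-sum hypermatrix $P(A)$ are non-negative and $\Delta(A)$ is a monotone hypertriangle of order $n$.
   Context: $\Xi(A)_{i,j,k}=\sum_{a=1}^i\sum_{b=1}^j\sum_{c=1}^k A_{a,b,c}$ for $i,j,k\in[0,n]$. A corner-sum hypermatrix of order $n$ is an integer array $C$ indexed by $[0,n]^3$ with $C_{i,j,0}=C_{i,0,j}=C_{0,i,j}=0$, $C_{i,j,n}=C_{i,n,j}=C_{n,i,j}=ij$ for all $i,j\in[0,n]$, and for all $i,j\in[0,n]$, $1\le k\le n$, each of $C_{i,j,k}-C_{i,j,k-1}$, $C_{i,k,j}-C_{i,k-1,j}$, $C_{k,i,j}-C_{k-1,i,j}$ in $\{\max(0,i+j-n),\dots,\min(i,j)\}$. The partial-sum hypermatrix is $P(A)_{i,j,k}=\sum_{a=1}^i\sum_{b=1}^k A_{a,j,b}$ for $i,j,k\in[n]$. When all entries of $P(A)$ are non-negative, $\Delta(A)$ is the family of finite sequences (rows) $\Delta(A)_{i,*,k}$, $i,k\in[n]$, where $\Delta(A)_{i,*,k}$ is the weakly increasing sequence in which each $j\in[n]$ occurs exactly $P(A)_{i,j,k}$ times. A monotone hypertriangle of order $n$ is a family $M$ of finite weakly increasing sequences $M_{i,*,k}$ ("row $i$ of plane $k$"), $i,k\in[n]$, with entries in $[n]$, such that for all $i,j,k\in[n]$: (1) $M_{i,*,k}$ has $ik$ entries; (2) each $j\in[n]$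 occurs between $\max(0,i+k-n)$ and $\min(i,k)$ times in $M_{i,*,k}$; (3) from one row to the next in plane $k$ (from $M_{i,*,k}$ to $M_{i+1,*,k}$), the increase in the number of entries $\le j$ is between $\max(0,j+k-n)$ and $\min(j,k)$; (4) from one plane to the next in row $i$ (from $M_{i,*,k}$ to $M_{i,*,k+1}$), the increase in the number of entries $\le j$ is between $\max(0,i+j-n)$ and $\min(i,j)$. -}

module Defs where

open import Data.Nat as ℕ using (ℕ; zero; suc; _∸_; _⊓_; _≤?_; _≟_)
open import Data.Integer as ℤ using (ℤ; +_; ∣_∣)
open import Data.List using (List; length; filter; concatMap; replicate; applyUpTo)
open import Data.List.Relation.Unary.All using (All)
open import Data.List.Relation.Unary.Linked using (Linked)
open import Data.Product using (_×_)
open import Relation.Binary.PropositionalEquality using (_≡_)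

-- Integer n×n×n hypermatrices (and (n+1)^3 arrays indexed by [0,n]^3) are
-- represented as functions ℕ → ℕ → ℕ → ℤ; only entries with indices in
-- the relevant range ([1,n] resp. [0,n]) are ever consulted.
Hyper : Set
Hyper = ℕ → ℕ → ℕ → ℤ

sumTo : ℕ → (ℕ → ℤ) → ℤ
sumTo zero    f = + 0
sumTo (suc i) f = sumTo i f ℤ.+ f (suc i)

oneTo : ℕ → List ℕ
oneTo n = applyUpTo suc n

InRange : ℕ → ℕ → ℤ → Set
InRange lo hi x = (+ lo ℤ.≤ x) × (x ℤ.≤ + hi)

Ξ : Hyper → Hyper
Ξ A i j k = sumTo i (λ a → sumTo j (λ b → sumTo k (λ c → A a b c)))

record IsCornerSum (n : ℕ) (C : Hyper) : Set where
  field
    zero₃ : ∀ i j → i ℕ.≤ n → j ℕ.≤ n → C i j 0 ≡ + 0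
    zero₂ : ∀ i j → i ℕ.≤ n → j ℕ.≤ n → C i 0 j ≡ + 0
    zero₁ : ∀ i j → i ℕ.≤ n → j ℕ.≤ n → C 0 i j ≡ + 0
    full₃ : ∀ i j → i ℕ.≤ n → j ℕ.≤ n → C i j n ≡ + (i ℕ.* j)
    full₂ : ∀ i j → i ℕ.≤ n → j ℕ.≤ n → C i n j ≡ + (i ℕ.* j)
    full₁ : ∀ i j → i ℕ.≤ n → j ℕ.≤ n → C n i j ≡ + (i ℕ.* j)
    step₃ : ∀ i j k → i ℕ.≤ n → j ℕ.≤ n → 1 ℕ.≤ k → k ℕ.≤ n →
            InRange ((i ℕ.+ j) ∸ n) (i ⊓ j) (C i j k ℤ.- C i j (k ∸ 1))
    step₂ : ∀ i j k → i ℕ.≤ n → j ℕ.≤ n → 1 ℕ.≤ k → k ℕ.≤ n →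
            InRange ((i ℕ.+ j) ∸ n) (i ⊓ j) (C i k j ℤ.- C i (k ∸ 1) j)
    step₁ : ∀ i j k → i ℕ.≤ n → j ℕ.≤ n → 1 ℕ.≤ k → k ℕ.≤ n →
            InRange ((i ℕ.+ j) ∸ n) (i ⊓ j) (C k i j ℤ.- C (k ∸ 1) i j)

P : Hyper → Hyper
P A i j k = sumTo i (λ a → sumTo k (λ b → A a j b))

PNonneg : ℕ → Hyper → Set
PNonneg n A = ∀ i j k → 1 ℕ.≤ i → i ℕ.≤ n → 1 ℕ.≤ j → j ℕ.≤ n →
              1 ℕ.≤ k → k ℕ.≤ n → + 0 ℤ.≤ P A i j k

-- A family of finite sequences M i k ("row i of plane k")
Family : Set
Family = ℕ → ℕ → List ℕ

-- Δ(A)_{i,*,k}: the weakly increasing sequence in which each j ∈ [n]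
-- occurs exactly P(A)_{i,j,k} times (only meaningful when P(A) ≥ 0,
-- where ∣ P(A)_{i,j,k} ∣ = P(A)_{i,j,k}).
Δ : ℕ → Hyper → Family
Δ n A i k = concatMap (λ j → replicate ∣ P A i j k ∣ j) (oneTo n)

occ : ℕ → List ℕ → ℕ
occ j xs = length (filter (_≟ j) xs)

atMost : ℕ → List ℕ → ℕ
atMost j xs = length (filter (_≤? j) xs)

InRangeℕ : ℕ → ℕ → ℕ → Set
InRangeℕ lo hi x = (lo ℕ.≤ x) × (x ℕ.≤ hi)

record IsMonotoneHypertriangle (n : ℕ) (M : Family) : Set where
  field
    weaklyIncr : ∀ i k → 1 ℕ.≤ i → i ℕ.≤ n → 1 ℕ.≤ k → k ℕ.≤ n →
                 Linked ℕ._≤_ (M i k)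
    entries    : ∀ i k → 1 ℕ.≤ i → i ℕ.≤ n → 1 ℕ.≤ k → k ℕ.≤ n →
                 All (λ x → (1 ℕ.≤ x) × (x ℕ.≤ n)) (M i k)
    -- (1)
    len        : ∀ i k → 1 ℕ.≤ i → i ℕ.≤ n → 1 ℕ.≤ k → k ℕ.≤ n →
                 length (M i k) ≡ i ℕ.* k
    -- (2)
    mult       : ∀ i j k → 1 ℕ.≤ i → i ℕ.≤ n → 1 ℕ.≤ j → j ℕ.≤ n →
                 1 ℕ.≤ k → k ℕ.≤ n →
                 InRangeℕ ((i ℕ.+ k) ∸ n) (i ⊓ k) (occ j (M i k))
    -- (3) row i to row i+1 in plane k (both rows in [n])
    rowStep    : ∀ i j k → 1 ℕ.≤ i → suc i ℕ.≤ n → 1 ℕ.≤ j → j ℕ.≤ n →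
                 1 ℕ.≤ k → k ℕ.≤ n →
                 (atMost j (M i k) ℕ.≤ atMost j (M (suc i) k)) ×
                 InRangeℕ ((j ℕ.+ k) ∸ n) (j ⊓ k)
                   (atMost j (M (suc i) k) ∸ atMost j (M i k))
    -- (4) plane k to plane k+1 in row i (both planes in [n])
    planeStep  : ∀ i j k → 1 ℕ.≤ i → i ℕ.≤ n → 1 ℕ.≤ j → j ℕ.≤ n →
                 1 ℕ.≤ k → suc k ℕ.≤ n →
                 (atMost j (M i k) ℕ.≤ atMost j (M i (suc k))) ×
                 InRangeℕ ((i ℕ.+ j) ∸ n) (i ⊓ j)
                   (atMost j (M i (suc k)) ∸ atMost j (M i k))

-- Since Ξ(A)_{i,j,k} = Σ_{b ≤ j} P(A)_{i,b,k}, the j-differences of Ξ(A) are the entries of P(A).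
-- Once P(A) ≥ 0 these are the multiplicities in the row Δ(A)_{i,*,k}, so Ξ(A)_{i,j,k} is the number
-- of entries ≤ j of that row.  Under this dictionary the j-steps of a corner-sum hypermatrix are the
-- multiplicity bounds (2), its k-steps and i-steps are the plane and row steps (4) and (3), and the
-- face Ξ(A)_{i,n,k} = ik is the length condition (1).  The steps into the first plane or row have
-- no counterpart in (3) and (4): there all multiplicities are 0 or 1 and the row has length i
-- (resp. k), which bounds its partial counts.  On the faces k = n and i = n the multiplicities are
-- forced to equal i (resp. k), which gives the remaining boundary values.
module Submission where

open import Defs
open import Data.Nat using (ℕ; zero; suc; _+_; _*_; _∸_; _⊓_; _≤_; _<_; _≤′_; ≤′-refl; ≤′-step; _≤?_; _≟_; z≤n; s≤s)
import Data.Nat.Properties as ℕ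
open import Data.Integer as ℤ using (ℤ; +_; ∣_∣; +≤+)
import Data.Integer.Properties as ℤ
open import Algebra.Properties.AbelianGroup ℤ.+-0-abelianGroup using (xyx⁻¹≈y)
open import Algebra.Properties.CommutativeSemigroup ℤ.+-commutativeSemigroup using (interchange)
open import Algebra.Properties.CommutativeSemigroup ℕ.+-commutativeSemigroup using (xy∙z≈xz∙y)
open import Data.List using (List; []; _∷_; _++_; length; filter; concatMap; replicate)
import Data.List.Properties as List
open import Data.List.Relation.Unary.All as All using (All; [])
import Data.List.Relation.Unary.All.Properties as All
open import Data.List.Relation.Unary.Linked using (Linked; []; [-]; _∷_)
open import Data.Product using (_×_; _,_; proj₁; proj₂)
open import Function.Bundles using (_⇔_; mk⇔)
open import Relation.Nullary using (¬_)
open import Relation.Unary using (Decidable)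
open import Relation.Binary.PropositionalEquality

sumTo-cong : ∀ i {f g : ℕ → ℤ} → (∀ a → 1 ≤ a → a ≤ i → f a ≡ g a) → sumTo i f ≡ sumTo i g
sumTo-cong zero    f≗g = refl
sumTo-cong (suc i) f≗g =
  cong₂ ℤ._+_ (sumTo-cong i (λ a 1≤a a≤i → f≗g a 1≤a (ℕ.m≤n⇒m≤1+n a≤i))) (f≗g (suc i) (s≤s z≤n) ℕ.≤-refl)

sumTo-zero : ∀ i → sumTo i (λ _ → + 0) ≡ + 0
sumTo-zero zero    = refl
sumTo-zero (suc i) = cong (ℤ._+ + 0) (sumTo-zero i)

sumTo-+ : ∀ i (f g : ℕ → ℤ) → sumTo i (λ a → f a ℤ.+ g a) ≡ sumTo i f ℤ.+ sumTo i g
sumTo-+ zero    f g = refl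
sumTo-+ (suc i) f g =
  trans (cong (ℤ._+ (f (suc i) ℤ.+ g (suc i))) (sumTo-+ i f g))
        (interchange (sumTo i f) (sumTo i g) (f (suc i)) (g (suc i)))

sumTo-comm : ∀ i j (f : ℕ → ℕ → ℤ) →
             sumTo i (λ a → sumTo j (f a)) ≡ sumTo j (λ b → sumTo i (λ a → f a b))
sumTo-comm i zero    f = sumTo-zero i
sumTo-comm i (suc j) f =
  trans (sumTo-+ i (λ a → sumTo j (f a)) (λ a → f a (suc j)))
        (cong (ℤ._+ sumTo i (λ a → f a (suc j))) (sumTo-comm i j f))

Ξ≡sumTo-P : ∀ A i j k → Ξ A i j k ≡ sumTo j (λ b → P A i b k)
Ξ≡sumTo-P A i j k = sumTo-comm i j (λ a b → sumTo k (A a b))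

Ξ-zero₂ : ∀ A i k → Ξ A i 0 k ≡ + 0
Ξ-zero₂ A i k = sumTo-zero i

Ξ-zero₃ : ∀ A i j → Ξ A i j 0 ≡ + 0
Ξ-zero₃ A i j = trans (sumTo-cong i (λ _ _ _ → sumTo-zero j)) (sumTo-zero i)

Ξ-suc-∸ : ∀ A i j k → Ξ A i (suc j) k ℤ.- Ξ A i j k ≡ P A i (suc j) k
Ξ-suc-∸ A i j k = begin
  Ξ A i (suc j) k ℤ.- Ξ A i j k
    ≡⟨ cong₂ ℤ._-_ (Ξ≡sumTo-P A i (suc j) k) (Ξ≡sumTo-P A i j k) ⟩
  (sumTo j (λ b → P A i b k) ℤ.+ P A i (suc j) k) ℤ.- sumTo j (λ b → P A i b k)
    ≡⟨ xyx⁻¹≈y (sumTo j (λ b → P A i b k)) (P A i (suc j) k) ⟩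
  P A i (suc j) k ∎
  where open ≡-Reasoning

InRange⇒InRangeℕ : ∀ {lo hi x} → InRange lo hi (+ x) → InRangeℕ lo hi x
InRange⇒InRangeℕ (lo≤x , x≤hi) = ℤ.drop‿+≤+ lo≤x , ℤ.drop‿+≤+ x≤hi

InRangeℕ⇒InRange : ∀ {lo hi x} → InRangeℕ lo hi x → InRange lo hi (+ x)
InRangeℕ⇒InRange (lo≤x , x≤hi) = +≤+ lo≤x , +≤+ x≤hi

pos-∸ : ∀ {a b} → a ≤ b → + b ℤ.- + a ≡ + (b ∸ a)
pos-∸ {a} {b} a≤b = trans (ℤ.m-n≡m⊖n b a) (ℤ.⊖-≥ a≤b)

InRange-pos-∸ : ∀ {lo hi x y a b} → x ≡ + b → y ≡ + a →
                InRange lo hi (x ℤ.- y) → a ≤ b × InRangeℕ lo hi (b ∸ a)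
InRange-pos-∸ {lo} {hi} {a = a} {b} refl refl r@(lo≤d , _) =
  a≤b , InRange⇒InRangeℕ (subst (InRange lo hi) (pos-∸ a≤b) r)
  where
    a≤b : a ≤ b
    a≤b = ℤ.drop‿+≤+ (ℤ.0≤i-j⇒j≤i (ℤ.≤-trans (+≤+ z≤n) lo≤d))

pos-∸-InRange : ∀ {lo hi x y a b} → x ≡ + b → y ≡ + a →
                a ≤ b × InRangeℕ lo hi (b ∸ a) → InRange lo hi (x ℤ.- y)
pos-∸-InRange {lo} {hi} refl refl (a≤b , r) = subst (InRange lo hi) (sym (pos-∸ a≤b)) (InRangeℕ⇒InRange r)

m≤n⇒m+0≤n : ∀ {m n} → m ≤ n → m + 0 ≤ n
m≤n⇒m+0≤n {m} = ℕ.≤-trans (ℕ.≤-reflexive (ℕ.+-identityʳ m))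

InRange-boundary : ∀ {n} i j {x y} → i + j ≤ n → x ≡ + 0 → y ≡ + 0 →
                   InRange ((i + j) ∸ n) (i ⊓ j) (x ℤ.- y)
InRange-boundary _ _ i+j≤n refl refl = +≤+ (ℕ.≤-reflexive (ℕ.m≤n⇒m∸n≡0 i+j≤n)) , +≤+ z≤n

InRangeℕ-comm : ∀ {n i j x} → InRangeℕ ((j + i) ∸ n) (j ⊓ i) x → InRangeℕ ((i + j) ∸ n) (i ⊓ j) x
InRangeℕ-comm {n} {i} {j} r rewrite ℕ.+-comm i j | ℕ.⊓-comm i j = r

module _ {A : Set} {Q : A → Set} (Q? : Decidable Q) where

  length-filter-++ : ∀ xs ys → length (filter Q? (xs ++ ys)) ≡ length (filter Q? xs) + length (filter Q? ys)
  length-filter-++ xs ys = trans (cong length (List.filter-++ Q? xs ys)) (List.length-++ (filter Q? xs))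

  length-filter-replicate-accept : ∀ {x} → Q x → ∀ c → length (filter Q? (replicate c x)) ≡ c
  length-filter-replicate-accept qx c =
    trans (cong length (List.filter-all Q? (All.replicate⁺ c qx))) (List.length-replicate c)

  length-filter-replicate-reject : ∀ {x} → ¬ Q x → ∀ c → length (filter Q? (replicate c x)) ≡ 0
  length-filter-replicate-reject ¬qx c = cong length (List.filter-none Q? (All.replicate⁺ c ¬qx))

Linked-replicate : ∀ c y → Linked _≤_ (replicate c y)
Linked-replicate zero          y = []
Linked-replicate (suc zero)    y = [-]
Linked-replicate (suc (suc c)) y = ℕ.≤-refl ∷ Linked-replicate (suc c) y

Linked-++-replicate : ∀ {y} c xs → Linked _≤_ xs → All (_≤ y) xs → Linked _≤_ (xs ++ replicate c y)
Linked-++-replicate c       []            _          _            = Linked-replicate c _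
Linked-++-replicate zero    (x ∷ [])      _          _            = [-]
Linked-++-replicate (suc c) (x ∷ [])      _          (x≤y All.∷ _) = x≤y ∷ Linked-replicate (suc c) _
Linked-++-replicate c       (x ∷ x′ ∷ xs) (x≤x′ ∷ l) (_ All.∷ xs≤y) = x≤x′ ∷ Linked-++-replicate c (x′ ∷ xs) l xs≤y

module Histogram (g : ℕ → ℕ) where

  histogram : ℕ → List ℕ
  histogram m = concatMap (λ j → replicate (g j) j) (oneTo m)

  cumulative : ℕ → ℕ
  cumulative zero    = 0
  cumulative (suc m) = cumulative m + g (suc m)

  histogram-suc : ∀ m → histogram (suc m) ≡ histogram m ++ replicate (g (suc m)) (suc m)
  histogram-suc m = begin
    concatMap block (oneTo (suc m))            ≡⟨ cong (concatMap block) (List.applyUpTo-∷ʳ suc m) ⟨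
    concatMap block (oneTo m ++ suc m ∷ [])    ≡⟨ List.concatMap-++ block (oneTo m) (suc m ∷ []) ⟩
    histogram m ++ (block (suc m) ++ [])       ≡⟨ cong (histogram m ++_) (List.++-identityʳ (block (suc m))) ⟩
    histogram m ++ block (suc m)               ∎
    where
      open ≡-Reasoning
      block : ℕ → List ℕ
      block j = replicate (g j) j

  length-histogram : ∀ m → length (histogram m) ≡ cumulative m
  length-histogram zero    = refl
  length-histogram (suc m) rewrite histogram-suc m =
    trans (List.length-++ (histogram m)) (cong₂ _+_ (length-histogram m) (List.length-replicate (g (suc m))))

  histogram-bounded : ∀ m → All (λ x → (1 ≤ x) × (x ≤ m)) (histogram m)
  histogram-bounded zero    = []
  histogram-bounded (suc m) rewrite histogram-suc m =
    All.++⁺ (All.map (λ (1≤x , x≤m) → 1≤x , ℕ.m≤n⇒m≤1+n x≤m) (histogram-bounded m))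
            (All.replicate⁺ (g (suc m)) (s≤s z≤n , ℕ.≤-refl))

  histogram-sorted : ∀ m → Linked _≤_ (histogram m)
  histogram-sorted zero    = []
  histogram-sorted (suc m) rewrite histogram-suc m =
    Linked-++-replicate (g (suc m)) (histogram m) (histogram-sorted m)
      (All.map (λ (_ , x≤m) → ℕ.m≤n⇒m≤1+n x≤m) (histogram-bounded m))

  module _ {Q : ℕ → Set} (Q? : Decidable Q) where

    count : ℕ → ℕ
    count m = length (filter Q? (histogram m))

    count-suc : ∀ m → count (suc m) ≡ count m + length (filter Q? (replicate (g (suc m)) (suc m)))
    count-suc m rewrite histogram-suc m = length-filter-++ Q? (histogram m) _

    count-all : ∀ m → (∀ b → b ≤ m → Q b) → count m ≡ cumulative m
    count-all zero    _  = refl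
    count-all (suc m) qs = trans (count-suc m)
      (cong₂ _+_ (count-all m (λ b b≤m → qs b (ℕ.m≤n⇒m≤1+n b≤m)))
                 (length-filter-replicate-accept Q? (qs (suc m) ℕ.≤-refl) (g (suc m))))

    count-above : ∀ {j m} → j ≤′ m → (∀ b → j < b → b ≤ m → ¬ Q b) → count m ≡ count j
    count-above ≤′-refl _ = refl
    count-above {j} (≤′-step {m} j≤′m) ¬qs = trans (count-suc m)
      (trans (cong₂ _+_ (count-above j≤′m (λ b j<b b≤m → ¬qs b j<b (ℕ.m≤n⇒m≤1+n b≤m)))
                        (length-filter-replicate-reject Q? (¬qs (suc m) (s≤s (ℕ.≤′⇒≤ j≤′m)) ℕ.≤-refl) (g (suc m))))
             (ℕ.+-identityʳ (count j)))

  atMost-histogram : ∀ {j m} → j ≤ m → atMost j (histogram m) ≡ cumulative j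
  atMost-histogram {j} j≤m =
    trans (count-above (_≤? j) (ℕ.≤⇒≤′ j≤m) (λ _ j<b _ → ℕ.<⇒≱ j<b)) (count-all (_≤? j) j (λ _ b≤j → b≤j))

  occ-histogram : ∀ {j m} → 1 ≤ j → j ≤ m → occ j (histogram m) ≡ g j
  occ-histogram {suc j} {m} _ j<m = begin
    occ (suc j) (histogram m)
      ≡⟨ count-above (_≟ suc j) (ℕ.≤⇒≤′ j<m) (λ _ j<b _ b≡1+j → ℕ.<⇒≢ j<b (sym b≡1+j)) ⟩
    count (_≟ suc j) (suc j)
      ≡⟨ count-suc (_≟ suc j) j ⟩
    count (_≟ suc j) j + length (filter (_≟ suc j) (replicate (g (suc j)) (suc j)))
      ≡⟨ cong₂ _+_ none (length-filter-replicate-accept (_≟ suc j) refl (g (suc j))) ⟩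
    g (suc j) ∎
    where
      open ≡-Reasoning
      none : count (_≟ suc j) j ≡ 0
      none = count-above (_≟ suc j) (ℕ.≤⇒≤′ z≤n) (λ _ _ b≤j → ℕ.<⇒≢ (s≤s b≤j))

  sumTo≡cumulative : ∀ m → sumTo m (λ a → + g a) ≡ + cumulative m
  sumTo≡cumulative zero    = refl
  sumTo≡cumulative (suc m) =
    trans (cong (ℤ._+ + g (suc m)) (sumTo≡cumulative m)) (sym (ℤ.pos-+ (cumulative m) (g (suc m))))

  cumulative-const : ∀ {c} j → (∀ b → 1 ≤ b → b ≤ j → g b ≡ c) → cumulative j ≡ j * c
  cumulative-const     zero    _   = refl
  cumulative-const {c} (suc j) g≡c =
    trans (cong₂ _+_ (cumulative-const j (λ b 1≤b b≤j → g≡c b 1≤b (ℕ.m≤n⇒m≤1+n b≤j)))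
                     (g≡c (suc j) (s≤s z≤n) ℕ.≤-refl))
          (ℕ.+-comm (j * c) c)

  cumulative-mono : ∀ {j m} → j ≤′ m → cumulative j ≤ cumulative m
  cumulative-mono ≤′-refl            = ℕ.≤-refl
  cumulative-mono (≤′-step {m} j≤′m) = ℕ.≤-trans (cumulative-mono j≤′m) (ℕ.m≤m+n (cumulative m) (g (suc m)))

  cumulative-≤ : ∀ m → (∀ b → 1 ≤ b → b ≤ m → g b ≤ 1) → cumulative m ≤ m
  cumulative-≤ zero    _   = z≤n
  cumulative-≤ (suc m) g≤1 =
    ℕ.≤-trans (ℕ.+-mono-≤ (cumulative-≤ m (λ b 1≤b b≤m → g≤1 b 1≤b (ℕ.m≤n⇒m≤1+n b≤m)))
                          (g≤1 (suc m) (s≤s z≤n) ℕ.≤-refl))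
              (ℕ.≤-reflexive (ℕ.+-comm m 1))

  cumulative-gap : ∀ {j m} → j ≤′ m → (∀ b → 1 ≤ b → b ≤ m → g b ≤ 1) → cumulative m + j ≤ m + cumulative j
  cumulative-gap {j} ≤′-refl _ = ℕ.≤-reflexive (ℕ.+-comm (cumulative j) j)
  cumulative-gap {j} (≤′-step {m} j≤′m) g≤1 = begin
    cumulative m + g (suc m) + j  ≡⟨ xy∙z≈xz∙y (cumulative m) (g (suc m)) j ⟩
    cumulative m + j + g (suc m)  ≤⟨ ℕ.+-mono-≤ (cumulative-gap j≤′m (λ b 1≤b b≤m → g≤1 b 1≤b (ℕ.m≤n⇒m≤1+n b≤m)))
                                                (g≤1 (suc m) (s≤s z≤n) ℕ.≤-refl) ⟩
    m + cumulative j + 1          ≡⟨ ℕ.+-comm (m + cumulative j) 1 ⟩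
    suc m + cumulative j          ∎
    where open ℕ.≤-Reasoning

  cumulative-InRange : ∀ {j n} → j ≤ n → (∀ b → 1 ≤ b → b ≤ n → g b ≤ 1) →
                       InRangeℕ ((cumulative n + j) ∸ n) (cumulative n ⊓ j) (cumulative j)
  cumulative-InRange {j} {n} j≤n g≤1 =
    ℕ.m≤n+o⇒m∸n≤o (cumulative n + j) n (cumulative-gap (ℕ.≤⇒≤′ j≤n) g≤1) ,
    ℕ.⊓-glb (cumulative-mono (ℕ.≤⇒≤′ j≤n)) (cumulative-≤ j (λ b 1≤b b≤j → g≤1 b 1≤b (ℕ.≤-trans b≤j j≤n)))

module _ (n : ℕ) (A : Hyper) where

  multiplicity : ℕ → ℕ → ℕ → ℕ
  multiplicity i k j = ∣ P A i j k ∣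

  module Row (i k : ℕ) = Histogram (multiplicity i k)

  module _ (P≥0 : PNonneg n A) where

    P≡occ-Δ : ∀ i j k → 1 ≤ i → i ≤ n → 1 ≤ j → j ≤ n → 1 ≤ k → k ≤ n → P A i j k ≡ + occ j (Δ n A i k)
    P≡occ-Δ i j k 1≤i i≤n 1≤j j≤n 1≤k k≤n = begin
      P A i j k            ≡⟨ ℤ.0≤i⇒+∣i∣≡i (P≥0 i j k 1≤i i≤n 1≤j j≤n 1≤k k≤n) ⟨
      + ∣ P A i j k ∣      ≡⟨ cong +_ (Row.occ-histogram i k 1≤j j≤n) ⟨
      + occ j (Δ n A i k)  ∎
      where open ≡-Reasoning

    Ξ≡atMost-Δ : ∀ i j k → 1 ≤ i → i ≤ n → j ≤ n → 1 ≤ k → k ≤ n → Ξ A i j k ≡ + atMost j (Δ n A i k)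
    Ξ≡atMost-Δ i j k 1≤i i≤n j≤n 1≤k k≤n = begin
      Ξ A i j k                             ≡⟨ Ξ≡sumTo-P A i j k ⟩
      sumTo j (λ b → P A i b k)             ≡⟨ sumTo-cong j P≡multiplicity ⟩
      sumTo j (λ b → + multiplicity i k b)  ≡⟨ Row.sumTo≡cumulative i k j ⟩
      + Row.cumulative i k j                ≡⟨ cong +_ (Row.atMost-histogram i k j≤n) ⟨
      + atMost j (Δ n A i k)                ∎
      where
        open ≡-Reasoning
        P≡multiplicity : ∀ b → 1 ≤ b → b ≤ j → P A i b k ≡ + multiplicity i k b
        P≡multiplicity b 1≤b b≤j = sym (ℤ.0≤i⇒+∣i∣≡i (P≥0 i b k 1≤i i≤n 1≤b (ℕ.≤-trans b≤j j≤n) 1≤k k≤n))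

    Ξ≡length-Δ : ∀ i k → 1 ≤ i → i ≤ n → 1 ≤ k → k ≤ n → Ξ A i n k ≡ + length (Δ n A i k)
    Ξ≡length-Δ i k 1≤i i≤n 1≤k k≤n =
      trans (Ξ≡atMost-Δ i n k 1≤i i≤n ℕ.≤-refl 1≤k k≤n)
            (cong +_ (trans (Row.atMost-histogram i k {n} ℕ.≤-refl) (sym (Row.length-histogram i k n))))

  P-InRange : IsCornerSum n (Ξ A) → ∀ i j k → i ≤ n → 1 ≤ j → j ≤ n → k ≤ n →
              InRange ((i + k) ∸ n) (i ⊓ k) (P A i j k)
  P-InRange C i (suc j) k i≤n _ j≤n k≤n =
    subst (InRange _ _) (Ξ-suc-∸ A i j k) (IsCornerSum.step₂ C i k (suc j) i≤n k≤n (s≤s z≤n) j≤n)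

  cornerSum⇒hypertriangle : IsCornerSum n (Ξ A) → PNonneg n A × IsMonotoneHypertriangle n (Δ n A)
  cornerSum⇒hypertriangle C = P≥0 , record
    { weaklyIncr = λ i k _ _ _ _ → Row.histogram-sorted i k n
    ; entries    = λ i k _ _ _ _ → Row.histogram-bounded i k n
    ; len        = λ i k 1≤i i≤n 1≤k k≤n →
        ℤ.+-injective (trans (sym (Ξ≡length-Δ P≥0 i k 1≤i i≤n 1≤k k≤n)) (full₂ i k i≤n k≤n))
    ; mult       = λ i j k 1≤i i≤n 1≤j j≤n 1≤k k≤n → InRange⇒InRangeℕ
        (subst (InRange _ _) (P≡occ-Δ P≥0 i j k 1≤i i≤n 1≤j j≤n 1≤k k≤n) (P-InRange C i j k i≤n 1≤j j≤n k≤n))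
    ; rowStep    = λ i j k 1≤i i<n 1≤j j≤n 1≤k k≤n → InRange-pos-∸
        (Ξ≡atMost-Δ P≥0 (suc i) j k (s≤s z≤n) i<n j≤n 1≤k k≤n)
        (Ξ≡atMost-Δ P≥0 i j k 1≤i (ℕ.<⇒≤ i<n) j≤n 1≤k k≤n)
        (step₁ j k (suc i) j≤n k≤n (s≤s z≤n) i<n)
    ; planeStep  = λ i j k 1≤i i≤n 1≤j j≤n 1≤k k<n → InRange-pos-∸
        (Ξ≡atMost-Δ P≥0 i j (suc k) 1≤i i≤n j≤n (s≤s z≤n) k<n)
        (Ξ≡atMost-Δ P≥0 i j k 1≤i i≤n j≤n 1≤k (ℕ.<⇒≤ k<n))
        (step₃ i j (suc k) i≤n j≤n (s≤s z≤n) k<n)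
    }
    where
      open IsCornerSum C
      P≥0 : PNonneg n A
      P≥0 i j k _ i≤n 1≤j j≤n _ k≤n = ℤ.≤-trans (+≤+ z≤n) (proj₁ (P-InRange C i j k i≤n 1≤j j≤n k≤n))

  module _ (P≥0 : PNonneg n A) (M : IsMonotoneHypertriangle n (Δ n A)) where
    open IsMonotoneHypertriangle M

    Ξ-uniform : ∀ {i k c} j → 1 ≤ i → i ≤ n → j ≤ n → 1 ≤ k → k ≤ n →
                (i + k) ∸ n ≡ c → i ⊓ k ≡ c → Ξ A i j k ≡ + (j * c)
    Ξ-uniform {i} {k} {c} j 1≤i i≤n j≤n 1≤k k≤n lo≡c hi≡c =
      trans (Ξ≡atMost-Δ P≥0 i j k 1≤i i≤n j≤n 1≤k k≤n)
            (cong +_ (trans (Row.atMost-histogram i k j≤n) (Row.cumulative-const i k j multiplicity≡c)))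
      where
        multiplicity≡c : ∀ b → 1 ≤ b → b ≤ j → multiplicity i k b ≡ c
        multiplicity≡c b 1≤b b≤j with mult i b k 1≤i i≤n 1≤b (ℕ.≤-trans b≤j j≤n) 1≤k k≤n
        ... | lo≤occ , occ≤hi = trans (sym (Row.occ-histogram i k 1≤b (ℕ.≤-trans b≤j j≤n)))
          (ℕ.≤-antisym (subst (_ ≤_) hi≡c occ≤hi) (subst (_≤ _) lo≡c lo≤occ))

    atMost-Δ-thin : ∀ {i k} t j → 1 ≤ i → i ≤ n → 1 ≤ k → k ≤ n → j ≤ n → i * k ≡ t → i ⊓ k ≤ 1 →
                    InRangeℕ ((t + j) ∸ n) (t ⊓ j) (atMost j (Δ n A i k))
    atMost-Δ-thin {i} {k} t j 1≤i i≤n 1≤k k≤n j≤n ik≡t i⊓k≤1 =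
      subst₂ (λ s x → InRangeℕ ((s + j) ∸ n) (s ⊓ j) x) total (sym (Row.atMost-histogram i k j≤n))
        (Row.cumulative-InRange i k j≤n multiplicity≤1)
      where
        total : Row.cumulative i k n ≡ t
        total = trans (sym (Row.length-histogram i k n)) (trans (len i k 1≤i i≤n 1≤k k≤n) ik≡t)
        multiplicity≤1 : ∀ b → 1 ≤ b → b ≤ n → multiplicity i k b ≤ 1
        multiplicity≤1 b 1≤b b≤n = subst (_≤ 1) (Row.occ-histogram i k 1≤b b≤n)
          (ℕ.≤-trans (proj₂ (mult i b k 1≤i i≤n 1≤b b≤n 1≤k k≤n)) i⊓k≤1)

    Ξ-full₃ : ∀ i j → i ≤ n → j ≤ n → Ξ A i j n ≡ + (i * j)
    Ξ-full₃ zero    j       _   _   = refl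
    Ξ-full₃ (suc i) zero    _   _   = trans (Ξ-zero₂ A (suc i) n) (cong +_ (sym (ℕ.*-zeroʳ (suc i))))
    Ξ-full₃ (suc i) (suc j) i≤n j≤n =
      trans (Ξ-uniform (suc j) (s≤s z≤n) i≤n j≤n (ℕ.≤-trans (s≤s z≤n) i≤n) ℕ.≤-refl
                       (ℕ.m+n∸n≡m (suc i) n) (ℕ.m≤n⇒m⊓n≡m i≤n))
            (cong +_ (ℕ.*-comm (suc j) (suc i)))

    Ξ-full₂ : ∀ i j → i ≤ n → j ≤ n → Ξ A i n j ≡ + (i * j)
    Ξ-full₂ zero    j       _   _   = refl
    Ξ-full₂ (suc i) zero    _   _   = trans (Ξ-zero₃ A (suc i) n) (cong +_ (sym (ℕ.*-zeroʳ (suc i))))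
    Ξ-full₂ (suc i) (suc j) i≤n j≤n =
      trans (Ξ≡length-Δ P≥0 (suc i) (suc j) (s≤s z≤n) i≤n (s≤s z≤n) j≤n)
            (cong +_ (len (suc i) (suc j) (s≤s z≤n) i≤n (s≤s z≤n) j≤n))

    Ξ-full₁ : ∀ i j → i ≤ n → j ≤ n → Ξ A n i j ≡ + (i * j)
    Ξ-full₁ zero    j       _   _   = Ξ-zero₂ A n j
    Ξ-full₁ (suc i) zero    _   _   = trans (Ξ-zero₃ A n (suc i)) (cong +_ (sym (ℕ.*-zeroʳ (suc i))))
    Ξ-full₁ (suc i) (suc j) i≤n j≤n =
      Ξ-uniform (suc i) (ℕ.≤-trans (s≤s z≤n) i≤n) ℕ.≤-refl i≤n (s≤s z≤n) j≤n
                (ℕ.m+n∸m≡n n (suc j)) (ℕ.m≥n⇒m⊓n≡n j≤n)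

    Ξ-step₃ : ∀ i j k → i ≤ n → j ≤ n → 1 ≤ k → k ≤ n →
              InRange ((i + j) ∸ n) (i ⊓ j) (Ξ A i j k ℤ.- Ξ A i j (k ∸ 1))
    Ξ-step₃ zero    j       k             _   j≤n _ _ = InRange-boundary 0 j j≤n refl refl
    Ξ-step₃ (suc i) zero    k             i≤n _   _ _ =
      InRange-boundary (suc i) 0 (m≤n⇒m+0≤n i≤n) (Ξ-zero₂ A (suc i) k) (Ξ-zero₂ A (suc i) (k ∸ 1))
    Ξ-step₃ (suc i) (suc j) (suc zero)    i≤n j≤n _ 1≤n =
      pos-∸-InRange (Ξ≡atMost-Δ P≥0 (suc i) (suc j) 1 (s≤s z≤n) i≤n j≤n (s≤s z≤n) 1≤n)
                    (Ξ-zero₃ A (suc i) (suc j))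
        (z≤n , atMost-Δ-thin (suc i) (suc j) (s≤s z≤n) i≤n (s≤s z≤n) 1≤n j≤n
                             (ℕ.*-identityʳ (suc i)) (ℕ.m⊓n≤n (suc i) 1))
    Ξ-step₃ (suc i) (suc j) (suc (suc k)) i≤n j≤n _ k<n =
      pos-∸-InRange
        (Ξ≡atMost-Δ P≥0 (suc i) (suc j) (suc (suc k)) (s≤s z≤n) i≤n j≤n (s≤s z≤n) k<n)
        (Ξ≡atMost-Δ P≥0 (suc i) (suc j) (suc k) (s≤s z≤n) i≤n j≤n (s≤s z≤n) (ℕ.<⇒≤ k<n))
        (planeStep (suc i) (suc j) (suc k) (s≤s z≤n) i≤n (s≤s z≤n) j≤n (s≤s z≤n) k<n)

    Ξ-step₂ : ∀ i j k → i ≤ n → j ≤ n → 1 ≤ k → k ≤ n →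
              InRange ((i + j) ∸ n) (i ⊓ j) (Ξ A i k j ℤ.- Ξ A i (k ∸ 1) j)
    Ξ-step₂ zero    j       k       _   j≤n _ _   = InRange-boundary 0 j j≤n refl refl
    Ξ-step₂ (suc i) zero    k       i≤n _   _ _   =
      InRange-boundary (suc i) 0 (m≤n⇒m+0≤n i≤n) (Ξ-zero₃ A (suc i) k) (Ξ-zero₃ A (suc i) (k ∸ 1))
    Ξ-step₂ (suc i) (suc j) (suc k) i≤n j≤n _ k≤n =
      subst (InRange _ _)
        (sym (trans (Ξ-suc-∸ A (suc i) k (suc j))
                    (P≡occ-Δ P≥0 (suc i) (suc k) (suc j) (s≤s z≤n) i≤n (s≤s z≤n) k≤n (s≤s z≤n) j≤n)))
        (InRangeℕ⇒InRange (mult (suc i) (suc k) (suc j) (s≤s z≤n) i≤n (s≤s z≤n) k≤n (s≤s z≤n) j≤n))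

    Ξ-step₁ : ∀ i j k → i ≤ n → j ≤ n → 1 ≤ k → k ≤ n →
              InRange ((i + j) ∸ n) (i ⊓ j) (Ξ A k i j ℤ.- Ξ A (k ∸ 1) i j)
    Ξ-step₁ zero    j       k             _   j≤n _ _ =
      InRange-boundary 0 j j≤n (Ξ-zero₂ A k j) (Ξ-zero₂ A (k ∸ 1) j)
    Ξ-step₁ (suc i) zero    k             i≤n _   _ _ =
      InRange-boundary (suc i) 0 (m≤n⇒m+0≤n i≤n) (Ξ-zero₃ A k (suc i)) (Ξ-zero₃ A (k ∸ 1) (suc i))
    Ξ-step₁ (suc i) (suc j) (suc zero)    i≤n j≤n _ 1≤n =
      pos-∸-InRange (Ξ≡atMost-Δ P≥0 1 (suc i) (suc j) (s≤s z≤n) 1≤n i≤n (s≤s z≤n) j≤n) refl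
        (z≤n , InRangeℕ-comm {n} (atMost-Δ-thin (suc j) (suc i) (s≤s z≤n) 1≤n (s≤s z≤n) j≤n i≤n
                                                (ℕ.*-identityˡ (suc j)) (ℕ.m⊓n≤m 1 (suc j))))
    Ξ-step₁ (suc i) (suc j) (suc (suc k)) i≤n j≤n _ k<n =
      pos-∸-InRange
        (Ξ≡atMost-Δ P≥0 (suc (suc k)) (suc i) (suc j) (s≤s z≤n) k<n i≤n (s≤s z≤n) j≤n)
        (Ξ≡atMost-Δ P≥0 (suc k) (suc i) (suc j) (s≤s z≤n) (ℕ.<⇒≤ k<n) i≤n (s≤s z≤n) j≤n)
        (rowStep (suc k) (suc i) (suc j) (s≤s z≤n) k<n (s≤s z≤n) i≤n (s≤s z≤n) j≤n)

  hypertriangle⇒cornerSum : PNonneg n A × IsMonotoneHypertriangle n (Δ n A) → IsCornerSum n (Ξ A)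
  hypertriangle⇒cornerSum (P≥0 , M) = record
    { zero₃ = λ i j _ _ → Ξ-zero₃ A i j
    ; zero₂ = λ i j _ _ → Ξ-zero₂ A i j
    ; zero₁ = λ _ _ _ _ → refl
    ; full₃ = Ξ-full₃ P≥0 M
    ; full₂ = Ξ-full₂ P≥0 M
    ; full₁ = Ξ-full₁ P≥0 M
    ; step₃ = Ξ-step₃ P≥0 M
    ; step₂ = Ξ-step₂ P≥0 M
    ; step₁ = Ξ-step₁ P≥0 M
    }

mainTheorem8 : (n : ℕ) (A : Hyper) →
    IsCornerSum n (Ξ A) ⇔ (PNonneg n A × IsMonotoneHypertriangle n (Δ n A))
mainTheorem8 n A = mk⇔ (cornerSum⇒hypertriangle n A) (hypertriangle⇒cornerSum n A)
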